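{- Let $\lambda$ be any partition with conjugate partition $\lambda'$, and let $n$ be the size of its Durfee square, i.e. the largest $n$ with $\lambda_n\ge n$. Then for all $1\le j\le i\le n$, \[ \sum_{k=j}^{n}(-1)^{j-k}\,D_{i,k}\binom{\lambda'_k-j}{k-j}=\delta_{ij}, \] where $\delta_{ij}$ is the Kronecker delta.
   Context: For a partition $\lambda=(\lambda_1\ge\lambda_2\ge\cdots)$ with conjugate $\lambda'$, its Young diagram $D$ is the set of boxes $(i,j)$ (row $i$ from the top, column $j$ from the left) with $1\le j\le\lambda_i$. For a box $(i,j)\in D$, $D_{i,j}$ denotes the number of lattice paths inside $D$ from the lowest box $(\lambda'_j,j)$ of column $j$ to the rightmost box $(i,\lambda_i)$ of row $i$, where each step goes from a box $(a,b)$ to its northern neighbour $(a-1,b)$ or its eastern neighbour $(a,b+1)$, and every box of the path lies in $D$. -}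

module Defs where

open import Data.Nat using (ℕ; zero; suc; _+_; _∸_; _≤_; _<_; _≤?_; _≟_)
open import Data.Nat.Combinatorics using (_C_)
open import Data.Integer as ℤ using (ℤ; +_)
open import Data.List using (List; []; _∷_; length; filter; foldr; map; upTo)
open import Data.List.Relation.Unary.Linked using (Linked)
open import Data.Bool using (Bool; true; false; _∧_; if_then_else_)
open import Relation.Nullary.Decidable using (⌊_⌋)
open import Data.Sum using (_⊎_)
open import Data.Product using (_×_)
open import Relation.Binary.PropositionalEquality using (_≡_)

IsPartition : List ℕ → Set
IsPartition l = Linked (λ a b → b ≤ a) l

-- λ_i, 1-indexed, with λ_i = 0 for i = 0 or i beyond the list.
part : List ℕ → ℕ → ℕ
part []       _             = 0
part (x ∷ xs) zero          = 0
part (x ∷ xs) (suc zero)    = x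
part (x ∷ xs) (suc (suc i)) = part xs (suc i)

conj : List ℕ → ℕ → ℕ
conj l j = length (filter (λ x → j ≤? x) l)

inD : List ℕ → ℕ → ℕ → Bool
inD l a b = ⌊ 1 ≤? a ⌋ ∧ ⌊ 1 ≤? b ⌋ ∧ ⌊ b ≤? part l a ⌋

-- paths l s a b ti tc = number of lattice paths with exactly s steps,
-- each step north (a,b) → (a-1,b) or east (a,b) → (a,b+1), all boxes in D,
-- from (a,b) to (ti,tc).
paths : List ℕ → ℕ → ℕ → ℕ → ℕ → ℕ → ℕ
paths l zero a b ti tc =
  if inD l a b ∧ ⌊ a ≟ ti ⌋ ∧ ⌊ b ≟ tc ⌋ then 1 else 0
paths l (suc s) a b ti tc =
  if inD l a b then paths l s (a ∸ 1) b ti tc + paths l s a (suc b) ti tc else 0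

-- D_{i,j}: number of lattice paths inside D from (λ'_j , j) to (i , λ_i).
-- Any N/E path between these boxes has exactly (λ'_j ∸ i) + (λ_i ∸ j) steps.
Dpaths : List ℕ → ℕ → ℕ → ℕ
Dpaths l i j = paths l ((conj l j ∸ i) + (part l i ∸ j)) (conj l j) j i (part l i)

sgn : ℕ → ℤ
sgn zero    = + 1
sgn (suc m) = ℤ.- sgn m

-- ∑_{k=a}^{b} f k  (empty if b < a)
sumFromTo : ℕ → ℕ → (ℕ → ℤ) → ℤ
sumFromTo a b f = foldr ℤ._+_ (+ 0) (map (λ t → f (a + t)) (upTo (suc b ∸ a)))

δ : ℕ → ℕ → ℤ
δ i j = if ⌊ i ≟ j ⌋ then + 1 else + 0

-- n is the size of the Durfee square: the largest n with λ_n ≥ n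
-- (n = 0 allowed, when no such positive n exists).
IsDurfee : List ℕ → ℕ → Set
IsDurfee l n = ((n ≡ 0) ⊎ (n ≤ part l n)) × (∀ m → 1 ≤ m → m ≤ part l m → m ≤ n)

-- Replace D_{i,k} by the number of lattice paths from (λ'_k , k) to an arbitrary box
-- (c , d) and call the resulting alternating sum F(c , d). Classifying paths by their last
-- step gives F(c , d) = E(c , d) + F(c + 1 , d) + F(c , d - 1), where E collects the paths
-- of length 0: it vanishes unless c = λ'_d is the bottom box of column d, and there it is
-- (-1)^(d-j) C(c - j , d - j) (also for d > n, where λ'_d < d makes the binomial 0).
-- The same recurrence and boundary values are satisfied by G(c , d) = (-1)^(d-j)
-- C(c - j - 1 , d - j) (read as 1 for c = j, and as 0 left of column j), by Pascal's rule.
-- Hence F = G on all boxes with c ≥ j, by induction on the column and, within a column,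
-- upwards from its bottom box. At (i , λ_i) we have λ_i ≥ i since i lies in the Durfee
-- square, so C(i - j - 1 , λ_i - j) = 0 for i > j and G(i , λ_i) = δ_ij.
module Submission where

open import Defs
open import Data.Nat
  using (ℕ; zero; suc; pred; _∸_; _≤_; _<_; z≤n; s≤s; _≟_; _≤?_; _<?_)
open import Data.Nat.Properties
open import Data.Nat.Combinatorics using (_C_; nCk+nC[k+1]≡[n+1]C[k+1]; k>n⇒nCk≡0)
open import Data.List using (List; []; _∷_; length; foldr; applyUpTo; upTo)
open import Data.List.Properties using (filter-accept; filter-reject; map-applyUpTo; map-cong)
open import Data.List.Relation.Unary.Linked using ([]; [-]; _∷_; tail)
open import Data.List.Relation.Binary.Sublist.Propositional using (⊆-refl)
open import Data.List.Relation.Binary.Sublist.Propositional.Properties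
  using (filter⁺; length-mono-≤)
open import Data.Bool using (true; false; _∧_; if_then_else_)
open import Data.Product using (_×_; _,_; proj₁; proj₂)
open import Data.Product.Properties using (≡-dec; ,-injective)
open import Data.Sum using (inj₁; inj₂)
open import Data.Fin using (Fin; toℕ; fromℕ<)
open import Data.Fin.Properties using (toℕ<n; toℕ-fromℕ<; toℕ-injective; punchInᵢ≢i)
open import Data.Vec.Functional using (removeAt)
open import Function using (_∘_)
open import Relation.Nullary using (¬_; Dec; does; yes; no; contradiction)
open import Relation.Nullary.Decidable using (_×-dec_; dec-true; dec-false; isYes≗does; map′)
open import Relation.Binary.Definitions using (tri<; tri≈; tri>)
open import Relation.Binary.PropositionalEquality
open import Algebra.Properties.CommutativeSemigroup +-commutativeSemigroup
  using () renaming (interchange to +-interchange)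

private variable
  l xs : List ℕ
  x a b c d e : ℕ

-- Partitions and their conjugates

part-≤-head : IsPartition (x ∷ xs) → ∀ c → part (x ∷ xs) c ≤ x
part-≤-head _           zero          = z≤n
part-≤-head _           (suc zero)    = ≤-refl
part-≤-head [-]         (suc (suc c)) = z≤n
part-≤-head (y≤x ∷ xs↓) (suc (suc c)) = ≤-trans (part-≤-head xs↓ (suc c)) y≤x

part-antitone : IsPartition l → 1 ≤ a → a ≤ b → part l b ≤ part l a
part-antitone {[]}    _  _ _ = z≤n
part-antitone {_ ∷ _} {suc zero}    {b}           l↓ _ _ = part-≤-head l↓ b
part-antitone {_ ∷ _} {suc (suc a)} {suc (suc b)} l↓ _ (s≤s a≤b) =
  part-antitone (tail l↓) (s≤s z≤n) a≤b

conj-suc≤conj : ∀ l d → conj l (suc d) ≤ conj l d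
conj-suc≤conj l d =
  length-mono-≤ (filter⁺ (suc d ≤?_) (d ≤?_) (λ { refl → <⇒≤ }) (⊆-refl {x = l}))

conj-cons-≤ : d ≤ x → conj (x ∷ xs) d ≡ suc (conj xs d)
conj-cons-≤ {d} d≤x = cong length (filter-accept (d ≤?_) d≤x)

conj-cons-≰ : ¬ d ≤ x → conj (x ∷ xs) d ≡ conj xs d
conj-cons-≰ {d} d≰x = cong length (filter-reject (d ≤?_) d≰x)

≤-part⇒≤-conj : IsPartition l → 1 ≤ c → 1 ≤ d → d ≤ part l c → c ≤ conj l d
≤-part⇒≤-conj {[]} _ _ 1≤d d≤0 = contradiction d≤0 (<⇒≱ 1≤d)
≤-part⇒≤-conj {x ∷ xs} {suc c} {d} l↓ _ 1≤d d≤part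
  rewrite conj-cons-≤ {xs = xs} (≤-trans d≤part (part-≤-head l↓ (suc c))) with c
... | zero   = s≤s z≤n
... | suc c′ = s≤s (≤-part⇒≤-conj (tail l↓) (s≤s z≤n) 1≤d d≤part)

≤-conj⇒≤-part : IsPartition l → 1 ≤ c → c ≤ conj l d → d ≤ part l c
≤-conj⇒≤-part {x ∷ xs} {suc c} {d} l↓ _ c≤conj with d ≤? x
... | no d≰x = contradiction (≤-trans d≤part (part-≤-head l↓ (suc (suc c)))) d≰x
  where
  d≤part = ≤-conj⇒≤-part (tail l↓) (s≤s z≤n) (subst (suc c ≤_) (conj-cons-≰ d≰x) c≤conj)
... | yes d≤x with c | subst (suc c ≤_) (conj-cons-≤ d≤x) c≤conj
...   | zero   | _           = d≤x
...   | suc c′ | s≤s c≤conj′ = ≤-conj⇒≤-part (tail l↓) (s≤s z≤n) c≤conj′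

-- Lattice paths in the Young diagram

module _ (l : List ℕ) where

  open import Data.Nat using (_+_)

  record Box (a b : ℕ) : Set where
    constructor box
    field
      1≤row    : 1 ≤ a
      1≤col    : 1 ≤ b
      col≤part : b ≤ part l a

  box? : ∀ a b → Dec (Box a b)
  box? a b = map′ (λ (p , q , r) → box p q r) (λ (box p q r) → p , q , r)
                  (1 ≤? a ×-dec 1 ≤? b ×-dec b ≤? part l a)

  inD≡does : inD l a b ≡ does (box? a b)
  inD≡does {a} {b} = cong₂ _∧_ (isYes≗does (1 ≤? a))
                               (cong₂ _∧_ (isYes≗does (1 ≤? b)) (isYes≗does (b ≤? part l a)))

  inD-true : Box a b → inD l a b ≡ true
  inD-true {a} {b} ab = trans (inD≡does {a} {b}) (dec-true (box? a b) ab)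

  inD-false : ¬ Box a b → inD l a b ≡ false
  inD-false {a} {b} ¬ab = trans (inD≡does {a} {b}) (dec-false (box? a b) ¬ab)

  paths-step : Box a b → ∀ s c d →
    paths l (suc s) a b c d ≡ paths l s (a ∸ 1) b c d + paths l s a (suc b) c d
  paths-step {a} {b} ab s c d =
    cong (if_then paths l s (a ∸ 1) b c d + paths l s a (suc b) c d else 0) (inD-true ab)

  paths-from-outside : ∀ s → ¬ Box a b → paths l s a b c d ≡ 0
  paths-from-outside zero ¬ab = cong (λ z → if z ∧ _ then 1 else 0) (inD-false ¬ab)
  paths-from-outside {a} {b} {c} {d} (suc s) ¬ab =
    cong (if_then paths l s (a ∸ 1) b c d + paths l s a (suc b) c d else 0) (inD-false ¬ab)

  paths₀-≢ : (a , b) ≢ (c , d) → paths l 0 a b c d ≡ 0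
  paths₀-≢ {a} {b} {c} {d} ab≢cd with inD l a b | a ≟ c | b ≟ d
  ... | false | _        | _        = refl
  ... | true  | no _     | _        = refl
  ... | true  | yes _    | no _     = refl
  ... | true  | yes refl | yes refl = contradiction refl ab≢cd

  paths₀-refl : Box a b → paths l 0 a b a b ≡ 1
  paths₀-refl {a} {b} ab with inD l a b in inD≡ | a ≟ a | b ≟ b
  ... | true  | yes _ | yes _ = refl
  ... | true  | no ¬p | _     = contradiction refl ¬p
  ... | true  | yes _ | no ¬p = contradiction refl ¬p
  ... | false | _     | _     = contradiction (trans (sym inD≡) (inD-true ab)) λ ()

  paths₀-north : Box a b → Box c d → paths l 0 (a ∸ 1) b c d ≡ paths l 0 a b (suc c) d
  paths₀-north {zero} (box () _ _) _
  paths₀-north {suc a} {b} {c} {d} ab cd with ≡-dec _≟_ _≟_ (suc a , b) (suc c , d)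
  ... | yes refl = trans (paths₀-refl cd) (sym (paths₀-refl ab))
  ... | no ne    = trans (paths₀-≢ (ne ∘ cong (λ (x , y) → suc x , y))) (sym (paths₀-≢ ne))

  paths₀-east : Box a b → Box c d → paths l 0 a (suc b) c d ≡ paths l 0 a b c (d ∸ 1)
  paths₀-east {d = zero} _ (box _ () _)
  paths₀-east {a} {b} {c} {suc d} ab cd with ≡-dec _≟_ _≟_ (a , b) (c , d)
  ... | yes refl = trans (paths₀-refl cd) (sym (paths₀-refl ab))
  ... | no ne    = trans (paths₀-≢ (ne ∘ cong (λ (x , y) → x , pred y))) (sym (paths₀-≢ ne))

  paths-vanish : ∀ s → ¬ (c ≤ a × b ≤ d × Box c d) → paths l s a b c d ≡ 0
  paths-vanish {c} {a} {b} {d} zero ¬reach with ≡-dec _≟_ _≟_ (a , b) (c , d)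
  ... | yes refl = paths-from-outside 0 (λ ab → ¬reach (≤-refl , ≤-refl , ab))
  ... | no ne    = paths₀-≢ ne
  paths-vanish {c} {a} {b} {d} (suc s) ¬reach with box? a b
  ... | no ¬ab = paths-from-outside (suc s) ¬ab
  ... | yes ab = trans (paths-step ab s c d) (cong₂ _+_
    (paths-vanish s λ (c≤a∸1 , b≤d , cd) → ¬reach (≤-trans c≤a∸1 (m∸n≤m a 1) , b≤d , cd))
    (paths-vanish s λ (c≤a , b<d , cd) → ¬reach (c≤a , <⇒≤ b<d , cd)))

  paths-last-step : ∀ s → Box c d →
    paths l (suc s) a b c d ≡ paths l s a b (suc c) d + paths l s a b c (d ∸ 1)
  paths-last-step {a = a} {b} s cd with box? a b
  ... | no ¬ab = trans (paths-from-outside (suc s) ¬ab)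
                       (sym (cong₂ _+_ (paths-from-outside s ¬ab) (paths-from-outside s ¬ab)))
  paths-last-step {c} {d} zero cd | yes ab =
    trans (paths-step ab 0 c d) (cong₂ _+_ (paths₀-north ab cd) (paths₀-east ab cd))
  paths-last-step {c} {d} {a} {b} (suc s) cd | yes ab = begin
    paths l (2 + s) a b c d
      ≡⟨ paths-step ab (1 + s) c d ⟩
    paths l (1 + s) (a ∸ 1) b c d + paths l (1 + s) a (suc b) c d
      ≡⟨ cong₂ _+_ (paths-last-step s cd) (paths-last-step s cd) ⟩
    (N₁ + W₁) + (N₂ + W₂)
      ≡⟨ +-interchange N₁ W₁ N₂ W₂ ⟩
    (N₁ + N₂) + (W₁ + W₂)
      ≡⟨ cong₂ _+_ (paths-step ab s (suc c) d) (paths-step ab s c (d ∸ 1)) ⟨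
    paths l (1 + s) a b (suc c) d + paths l (1 + s) a b c (d ∸ 1) ∎
    where
    open ≡-Reasoning
    N₁ = paths l s (a ∸ 1) b (suc c) d
    W₁ = paths l s (a ∸ 1) b c (d ∸ 1)
    N₂ = paths l s a (suc b) (suc c) d
    W₂ = paths l s a (suc b) c (d ∸ 1)

  -- A path from (a , b) to (c , d) has (a ∸ c) + (d ∸ b) steps (paths≡#paths).
  #paths : ℕ → ℕ → ℕ → ℕ → ℕ
  #paths a b c d = paths l ((a ∸ c) + (d ∸ b)) a b c d

  #paths-vanish : ∀ {a b c d} → ¬ (c ≤ a × b ≤ d × Box c d) → #paths a b c d ≡ 0
  #paths-vanish {a} {b} {c} {d} = paths-vanish ((a ∸ c) + (d ∸ b))

  paths≡#paths : ∀ s → (c ≤ a → b ≤ d → s ≡ (a ∸ c) + (d ∸ b)) →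
    paths l s a b c d ≡ #paths a b c d
  paths≡#paths {c} {a} {b} {d} s length with c ≤? a | b ≤? d
  ... | yes c≤a | yes b≤d = cong (λ s → paths l s a b c d) (length c≤a b≤d)
  ... | no c≰a  | _       = trans (paths-vanish s (c≰a ∘ proj₁))
                                  (sym (#paths-vanish {a} {b} {c} {d} (c≰a ∘ proj₁)))
  ... | _       | no b≰d  = trans (paths-vanish s (b≰d ∘ proj₁ ∘ proj₂))
                                  (sym (#paths-vanish {a} {b} {c} {d} (b≰d ∘ proj₁ ∘ proj₂)))

  #paths-last-step : Box c d →
    #paths a b c d ≡ (paths l 0 a b c d + #paths a b (suc c) d) + #paths a b c (d ∸ 1)
  #paths-last-step {d = zero} (box _ () _)
  #paths-last-step {c} {suc d} {a} {b} cd = by-length ((a ∸ c) + (suc d ∸ b)) refl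
    where
    open ≡-Reasoning
    N = #paths a b (suc c) (suc d)
    W = #paths a b c d

    by-length : ∀ ℓ → ℓ ≡ (a ∸ c) + (suc d ∸ b) →
      paths l ℓ a b c (suc d) ≡ (paths l 0 a b c (suc d) + N) + W
    by-length zero ℓ≡0 = sym (begin
      (paths l 0 a b c (suc d) + N) + W
        ≡⟨ cong₂ (λ n w → (paths l 0 a b c (suc d) + n) + w) N≡0 W≡0 ⟩
      (paths l 0 a b c (suc d) + 0) + 0
        ≡⟨ trans (+-identityʳ _) (+-identityʳ _) ⟩
      paths l 0 a b c (suc d) ∎)
      where
      a≤c : a ≤ c
      a≤c = m∸n≡0⇒m≤n (m+n≡0⇒m≡0 (a ∸ c) (sym ℓ≡0))
      d<b : d < b
      d<b = m∸n≡0⇒m≤n (m+n≡0⇒n≡0 (a ∸ c) (sym ℓ≡0))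
      N≡0 : N ≡ 0
      N≡0 = #paths-vanish {a} {b} {suc c} {suc d} λ (c<a , _) → <⇒≱ c<a a≤c
      W≡0 : W ≡ 0
      W≡0 = #paths-vanish {a} {b} {c} {d} λ (_ , b≤d , _) → <⇒≱ d<b b≤d
    by-length (suc s) ℓ≡ = begin
      paths l (suc s) a b c (suc d)
        ≡⟨ paths-last-step s cd ⟩
      paths l s a b (suc c) (suc d) + paths l s a b c d
        ≡⟨ cong₂ _+_ (paths≡#paths s north) (paths≡#paths s west) ⟩
      N + W
        ≡⟨ cong (λ p → (p + N) + W) (paths₀-≢ ab≢cd) ⟨
      (paths l 0 a b c (suc d) + N) + W ∎
      where
      north : suc c ≤ a → b ≤ suc d → s ≡ (a ∸ suc c) + (suc d ∸ b)
      north c<a _ = suc-injective (trans ℓ≡ (cong (_+ (suc d ∸ b)) (+-∸-assoc 1 c<a)))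
      west : c ≤ a → b ≤ d → s ≡ (a ∸ c) + (d ∸ b)
      west _ b≤d =
        suc-injective (trans ℓ≡ (trans (cong ((a ∸ c) +_) (+-∸-assoc 1 b≤d)) (+-suc _ _)))
      ab≢cd : (a , b) ≢ (c , suc d)
      ab≢cd ab≡cd = 1+n≢0 (trans ℓ≡ (cong₂ _+_
        (m≤n⇒m∸n≡0 (≤-reflexive (proj₁ (,-injective ab≡cd))))
        (m≤n⇒m∸n≡0 (≤-reflexive (sym (proj₂ (,-injective ab≡cd)))))))

-- Sums over ranges of integers

-- From here on _+_ is integer addition; natural addition is written Nat._+_.
open import Data.Integer using (ℤ; +_; -_; _+_; _*_)
import Data.Integer.Properties as ℤ
open import Data.Integer.Tactic.RingSolver using (solve-∀)
open import Algebra.Properties.CommutativeMonoid.Sum ℤ.+-0-commutativeMonoid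
  using (sum; sum-syntax; sum-cong-≗; sum-replicate-zero; sum-remove; ∑-distrib-+)
import Data.Nat as Nat

private variable
  f g : ℕ → ℤ
  w : ℕ → ℕ

∑-zero : ∀ {m} (h : Fin m → ℤ) → (∀ t → h t ≡ + 0) → ∑[ t < m ] h t ≡ + 0
∑-zero {m} h h≡0 = trans (sum-cong-≗ h≡0) (sum-replicate-zero m)

∑-single : ∀ {m} (h : Fin m → ℤ) i → (∀ t → t ≢ i → h t ≡ + 0) → ∑[ t < m ] h t ≡ h i
∑-single {suc m} h i h≡0 = begin
  sum h                     ≡⟨ sum-remove h ⟩
  h i + sum (removeAt h i)  ≡⟨ cong (λ x → h i + x) (∑-zero _ λ t → h≡0 _ (punchInᵢ≢i i t)) ⟩
  h i + + 0                 ≡⟨ ℤ.+-identityʳ (h i) ⟩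
  h i                       ∎
  where open ≡-Reasoning

foldr-applyUpTo : ∀ (h : ℕ → ℤ) m → foldr _+_ (+ 0) (applyUpTo h m) ≡ ∑[ t < m ] h (toℕ t)
foldr-applyUpTo h zero    = refl
foldr-applyUpTo h (suc m) = cong (λ x → h 0 + x) (foldr-applyUpTo (h ∘ suc) m)

sumFromTo≡∑ : ∀ a b f → sumFromTo a b f ≡ ∑[ t < suc b ∸ a ] f (a Nat.+ toℕ t)
sumFromTo≡∑ a b f = trans
  (cong (foldr _+_ (+ 0)) (map-applyUpTo (λ x → x) (λ t → f (a Nat.+ t)) (suc b ∸ a)))
  (foldr-applyUpTo (λ t → f (a Nat.+ t)) (suc b ∸ a))

index-≤ : ∀ a b (t : Fin (suc b ∸ a)) → a Nat.+ toℕ t ≤ b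
index-≤ a b t = subst (_≤ b) (+-comm (toℕ t) a)
  (≤-pred (m≤o∸n⇒m+n≤o (suc (toℕ t)) (<⇒≤ a<1+b) (toℕ<n t)))
  where
  a<1+b : a < suc b
  a<1+b = m∸n≢0⇒n<m (λ eq → n≮0 (subst (toℕ t <_) eq (toℕ<n t)))

sumFromTo-cong : (∀ k → f k ≡ g k) → sumFromTo a b f ≡ sumFromTo a b g
sumFromTo-cong {f} {g} {a} {b} f≗g =
  cong (foldr _+_ (+ 0)) (map-cong (λ t → f≗g (a Nat.+ t)) (upTo (suc b ∸ a)))

sumFromTo-+ : ∀ a b f g → sumFromTo a b (λ k → f k + g k) ≡ sumFromTo a b f + sumFromTo a b g
sumFromTo-+ a b f g = begin
  sumFromTo a b (λ k → f k + g k)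
    ≡⟨ sumFromTo≡∑ a b (λ k → f k + g k) ⟩
  ∑[ t < suc b ∸ a ] (f (a Nat.+ toℕ t) + g (a Nat.+ toℕ t))
    ≡⟨ ∑-distrib-+ {suc b ∸ a} _ _ ⟩
  ∑[ t < suc b ∸ a ] f (a Nat.+ toℕ t) + ∑[ t < suc b ∸ a ] g (a Nat.+ toℕ t)
    ≡⟨ cong₂ _+_ (sumFromTo≡∑ a b f) (sumFromTo≡∑ a b g) ⟨
  sumFromTo a b f + sumFromTo a b g ∎
  where open ≡-Reasoning

sumFromTo-zero : (∀ k → a ≤ k → k ≤ b → f k ≡ + 0) → sumFromTo a b f ≡ + 0
sumFromTo-zero {a} {b} {f} f≡0 =
  trans (sumFromTo≡∑ a b f) (∑-zero _ λ t → f≡0 _ (m≤m+n a (toℕ t)) (index-≤ a b t))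

sumFromTo-single : a ≤ e → e ≤ b → (∀ k → k ≢ e → f k ≡ + 0) → sumFromTo a b f ≡ f e
sumFromTo-single {a} {e} {b} {f} a≤e e≤b f≡0 = begin
  sumFromTo a b f                         ≡⟨ sumFromTo≡∑ a b f ⟩
  ∑[ t < suc b ∸ a ] f (a Nat.+ toℕ t)    ≡⟨ ∑-single _ i (λ t t≢i → f≡0 _ (t≢i ∘ index≡i)) ⟩
  f (a Nat.+ toℕ i)                       ≡⟨ cong (λ t → f (a Nat.+ t)) (toℕ-fromℕ< e∸a<m) ⟩
  f (a Nat.+ (e ∸ a))                     ≡⟨ cong f (m+[n∸m]≡n a≤e) ⟩
  f e                                     ∎
  where
  open ≡-Reasoning
  e∸a<m : e ∸ a < suc b ∸ a
  e∸a<m = ∸-monoˡ-< (s≤s e≤b) a≤e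
  i = fromℕ< e∸a<m
  index≡i : ∀ {t} → a Nat.+ toℕ t ≡ e → t ≡ i
  index≡i {t} eq = toℕ-injective (begin
    toℕ t                  ≡⟨ m+n∸m≡n a (toℕ t) ⟨
    (a Nat.+ toℕ t) ∸ a    ≡⟨ cong (_∸ a) eq ⟩
    e ∸ a                  ≡⟨ toℕ-fromℕ< e∸a<m ⟨
    toℕ i                  ∎)

-- Signed binomial coefficients

-- (-1)^e C(m - 1 , e), which for m = 0 is (-1)^e C(-1 , e) = 1.
signedBinomial : ℕ → ℕ → ℤ
signedBinomial zero    e = + 1
signedBinomial (suc m) e = sgn e * + (m C e)

signedBinomial-0 : ∀ m → signedBinomial m 0 ≡ + 1
signedBinomial-0 zero    = refl
signedBinomial-0 (suc m) = refl

signedBinomial-pascal : ∀ m e →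
  signedBinomial m (suc e) ≡ signedBinomial (suc m) (suc e) + signedBinomial m e
signedBinomial-pascal zero    e = sym (cong (_+ + 1) (ℤ.*-zeroʳ (sgn (suc e))))
signedBinomial-pascal (suc m) e = sym (begin
  - σ * + (suc m C suc e) + σ * + (m C e)
    ≡⟨ cong (λ x → - σ * + x + σ * + (m C e)) (nCk+nC[k+1]≡[n+1]C[k+1] m e) ⟨
  - σ * + (m C e Nat.+ m C suc e) + σ * + (m C e)
    ≡⟨ cong (λ x → - σ * x + σ * + (m C e)) (ℤ.pos-+ (m C e) (m C suc e)) ⟩
  - σ * (+ (m C e) + + (m C suc e)) + σ * + (m C e)
    ≡⟨ cancel σ (+ (m C e)) (+ (m C suc e)) ⟩
  - σ * + (m C suc e) ∎)
  where
  open ≡-Reasoning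
  σ = sgn e
  cancel : ∀ s x y → - s * (x + y) + s * x ≡ - s * y
  cancel = solve-∀

signedBinomial-δ : ∀ {m e} → m ≤ e → signedBinomial m e ≡ δ m 0
signedBinomial-δ {zero}      _   = refl
signedBinomial-δ {suc m} {e} m<e =
  trans (cong (λ x → sgn e * + x) (k>n⇒nCk≡0 m<e)) (ℤ.*-zeroʳ (sgn e))

δ-∸ : ∀ {i j} → j ≤ i → δ (i ∸ j) 0 ≡ δ i j
δ-∸ {i} {j} j≤i with i ≟ j
... | yes refl = cong (λ m → δ m 0) (n∸n≡0 i)
... | no i≢j with i ∸ j in i∸j≡
...   | zero  = contradiction (≤-antisym (m∸n≡0⇒m≤n i∸j≡) j≤i) i≢j
...   | suc _ = refl

module _ (j : ℕ) where

  closedForm : ℕ → ℕ → ℤ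
  closedForm c d = if does (d <? j) then + 0 else signedBinomial (c ∸ j) (d ∸ j)

  closedForm-< : d < j → closedForm c d ≡ + 0
  closedForm-< {d} {c} d<j =
    cong (λ z → if z then + 0 else signedBinomial (c ∸ j) (d ∸ j)) (dec-true (d <? j) d<j)

  closedForm-≥ : j ≤ d → closedForm c d ≡ signedBinomial (c ∸ j) (d ∸ j)
  closedForm-≥ {d} {c} j≤d =
    cong (λ z → if z then + 0 else signedBinomial (c ∸ j) (d ∸ j)) (dec-false (d <? j) (≤⇒≯ j≤d))

  closedForm-j : ∀ c → closedForm c j ≡ + 1
  closedForm-j c = trans (closedForm-≥ ≤-refl)
    (trans (cong (signedBinomial (c ∸ j)) (n∸n≡0 j)) (signedBinomial-0 (c ∸ j)))

  closedForm-suc : j ≤ c → j ≤ d → closedForm (suc c) d ≡ sgn (d ∸ j) * + ((c ∸ j) C (d ∸ j))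
  closedForm-suc {c} {d} j≤c j≤d =
    trans (closedForm-≥ j≤d) (cong (λ m → signedBinomial m (d ∸ j)) (+-∸-assoc 1 j≤c))

  closedForm-pascal : j ≤ c → closedForm c (suc d) ≡ closedForm (suc c) (suc d) + closedForm c d
  closedForm-pascal {c} {d} j≤c with <-cmp (suc d) j
  ... | tri< 1+d<j _ _ = trans (closedForm-< 1+d<j)
    (sym (cong₂ _+_ (closedForm-< 1+d<j) (closedForm-< (<-trans (n<1+n d) 1+d<j))))
  ... | tri≈ _ refl _ = trans (closedForm-j c)
    (sym (cong₂ _+_ (closedForm-j (suc c)) (closedForm-< {c = c} (n<1+n d))))
  ... | tri> _ _ j<1+d = begin
    closedForm c (suc d)
      ≡⟨ closedForm-≥ (<⇒≤ j<1+d) ⟩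
    signedBinomial (c ∸ j) (suc d ∸ j)
      ≡⟨ cong (signedBinomial (c ∸ j)) (+-∸-assoc 1 j≤d) ⟩
    signedBinomial (c ∸ j) (suc (d ∸ j))
      ≡⟨ signedBinomial-pascal (c ∸ j) (d ∸ j) ⟩
    signedBinomial (suc (c ∸ j)) (suc (d ∸ j)) + signedBinomial (c ∸ j) (d ∸ j)
      ≡⟨ cong (_+ signedBinomial (c ∸ j) (d ∸ j))
              (cong₂ signedBinomial (+-∸-assoc 1 j≤c) (+-∸-assoc 1 j≤d)) ⟨
    signedBinomial (suc c ∸ j) (suc d ∸ j) + signedBinomial (c ∸ j) (d ∸ j)
      ≡⟨ cong₂ _+_ (closedForm-≥ (<⇒≤ j<1+d)) (closedForm-≥ j≤d) ⟨
    closedForm (suc c) (suc d) + closedForm c d ∎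
    where
    open ≡-Reasoning
    j≤d = ≤-pred j<1+d

-- The alternating path sums

module _ (l : List ℕ) (n j : ℕ) where

  weightedTerm : (ℕ → ℕ) → ℕ → ℤ
  weightedTerm w k = sgn (k ∸ j) * (+ w k * + ((conj l k ∸ j) C (k ∸ j)))

  weighted : (ℕ → ℕ) → ℤ
  weighted w = sumFromTo j n (weightedTerm w)

  -- pathSum i (part l i) is the left-hand side of the theorem, as
  -- Dpaths l i k = #paths l (conj l k) k i (part l i) by definition.
  pathSum : ℕ → ℕ → ℤ
  pathSum c d = weighted (λ k → #paths l (conj l k) k c d)

  emptyPathSum : ℕ → ℕ → ℤ
  emptyPathSum c d = weighted (λ k → paths l 0 (conj l k) k c d)

  weightedTerm-zero : ∀ {w k} → w k ≡ 0 → weightedTerm w k ≡ + 0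
  weightedTerm-zero {w} {k} w≡0 = trans
    (cong (λ x → sgn (k ∸ j) * (+ x * + ((conj l k ∸ j) C (k ∸ j)))) w≡0)
    (ℤ.*-zeroʳ (sgn (k ∸ j)))

  weightedTerm-+ : ∀ u v k →
    weightedTerm (λ k → u k Nat.+ v k) k ≡ weightedTerm u k + weightedTerm v k
  weightedTerm-+ u v k = begin
    σ * (+ (u k Nat.+ v k) * β)        ≡⟨ cong (λ x → σ * (x * β)) (ℤ.pos-+ (u k) (v k)) ⟩
    σ * ((+ u k + + v k) * β)          ≡⟨ cong (σ *_) (ℤ.*-distribʳ-+ β (+ u k) (+ v k)) ⟩
    σ * (+ u k * β + + v k * β)        ≡⟨ ℤ.*-distribˡ-+ σ _ _ ⟩
    σ * (+ u k * β) + σ * (+ v k * β)  ∎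
    where
    open ≡-Reasoning
    σ = sgn (k ∸ j)
    β = + ((conj l k ∸ j) C (k ∸ j))

  weighted-cong : ∀ {u v} → (∀ k → u k ≡ v k) → weighted u ≡ weighted v
  weighted-cong {u} {v} u≗v = sumFromTo-cong {a = j} {n} λ k →
    cong (λ x → sgn (k ∸ j) * (+ x * + ((conj l k ∸ j) C (k ∸ j)))) (u≗v k)

  weighted-+ : ∀ u v → weighted (λ k → u k Nat.+ v k) ≡ weighted u + weighted v
  weighted-+ u v = trans (sumFromTo-cong {a = j} {n} (weightedTerm-+ u v))
                         (sumFromTo-+ j n (weightedTerm u) (weightedTerm v))

  weighted-zero : (∀ k → j ≤ k → k ≤ n → w k ≡ 0) → weighted w ≡ + 0
  weighted-zero {w} w≡0 = sumFromTo-zero {j} {n} {weightedTerm w} λ k j≤k k≤n →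
    weightedTerm-zero {w} (w≡0 k j≤k k≤n)

  weighted-single : j ≤ e → e ≤ n → (∀ k → k ≢ e → w k ≡ 0) → weighted w ≡ weightedTerm w e
  weighted-single {e} {w} j≤e e≤n w≡0 = sumFromTo-single {j} {e} {n} {weightedTerm w} j≤e e≤n
    λ k k≢e → weightedTerm-zero {w} (w≡0 k k≢e)

  pathSum-last-step : Box l c d →
    pathSum c d ≡ (emptyPathSum c d + pathSum (suc c) d) + pathSum c (d ∸ 1)
  pathSum-last-step {c} {d} cd = begin
    pathSum c d
      ≡⟨ weighted-cong (λ k → #paths-last-step l {a = conj l k} {b = k} cd) ⟩
    weighted (λ k → (S k Nat.+ N k) Nat.+ W k)
      ≡⟨ weighted-+ (λ k → S k Nat.+ N k) W ⟩
    weighted (λ k → S k Nat.+ N k) + weighted W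
      ≡⟨ cong (_+ weighted W) (weighted-+ S N) ⟩
    (weighted S + weighted N) + weighted W ∎
    where
    open ≡-Reasoning
    S N W : ℕ → ℕ
    S k = paths l 0 (conj l k) k c d
    N k = #paths l (conj l k) k (suc c) d
    W k = #paths l (conj l k) k c (d ∸ 1)

  pathSum-outside : ¬ Box l c d → pathSum c d ≡ + 0
  pathSum-outside {c} {d} ¬cd = weighted-zero λ k _ _ →
    #paths-vanish l {conj l k} {k} {c} {d} (¬cd ∘ proj₂ ∘ proj₂)

  emptyPathSum-off-bottom : c ≢ conj l d → emptyPathSum c d ≡ + 0
  emptyPathSum-off-bottom {c} {d} c≢λ′d = weighted-zero λ k _ _ →
    paths₀-≢ l {conj l k} {k} {c} {d} λ eq →
      c≢λ′d (trans (sym (proj₁ (,-injective eq))) (cong (conj l) (proj₂ (,-injective eq))))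

module _ {l : List ℕ} (l↓ : IsPartition l) {n : ℕ} (durfee : IsDurfee l n) where

  ≤-part-diagonal : ∀ {i} → 1 ≤ i → i ≤ n → i ≤ part l i
  ≤-part-diagonal {i} 1≤i i≤n with proj₁ durfee
  ... | inj₁ refl = contradiction (≤-trans 1≤i i≤n) λ ()
  ... | inj₂ n≤λn = ≤-trans i≤n (≤-trans n≤λn (part-antitone l↓ 1≤i i≤n))

  conj<beyond-durfee : n < d → conj l d < d
  conj<beyond-durfee {d} n<d = ≰⇒> λ d≤λ′d →
    <⇒≱ n<d (proj₂ durfee d 1≤d (≤-conj⇒≤-part l↓ 1≤d d≤λ′d))
    where 1≤d = ≤-trans (s≤s z≤n) n<d

  emptyPathSum-bottom : ∀ {j} → j ≤ c → c ≡ conj l d → Box l c d →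
    emptyPathSum l n j c d ≡ closedForm j (suc c) d
  emptyPathSum-bottom {c} {d} {j} j≤c refl cd with d <? j | d ≤? n
  ... | yes d<j | _ = trans
    (weighted-zero l n j λ k j≤k _ → paths₀-≢ l {conj l k} {k} {c} {d} λ eq →
      <⇒≱ d<j (subst (j ≤_) (proj₂ (,-injective eq)) j≤k))
    (sym (closedForm-< j d<j))
  ... | no d≮j | yes d≤n = begin
    emptyPathSum l n j c d
      ≡⟨ weighted-single l n j (≮⇒≥ d≮j) d≤n (λ k k≢d →
           paths₀-≢ l {conj l k} {k} {c} {d} (k≢d ∘ proj₂ ∘ ,-injective)) ⟩
    sgn (d ∸ j) * (+ paths l 0 c d c d * + ((c ∸ j) C (d ∸ j)))
      ≡⟨ cong (λ x → sgn (d ∸ j) * (+ x * + ((c ∸ j) C (d ∸ j)))) (paths₀-refl l cd) ⟩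
    sgn (d ∸ j) * (+ 1 * + ((c ∸ j) C (d ∸ j)))
      ≡⟨ cong (sgn (d ∸ j) *_) (ℤ.*-identityˡ _) ⟩
    sgn (d ∸ j) * + ((c ∸ j) C (d ∸ j))
      ≡⟨ closedForm-suc j j≤c (≮⇒≥ d≮j) ⟨
    closedForm j (suc c) d ∎
    where open ≡-Reasoning
  ... | no d≮j | no d≰n = begin
    emptyPathSum l n j c d
      ≡⟨ weighted-zero l n j (λ k _ k≤n → paths₀-≢ l {conj l k} {k} {c} {d} λ eq →
           d≰n (subst (_≤ n) (proj₂ (,-injective eq)) k≤n)) ⟩
    + 0
      ≡⟨ ℤ.*-zeroʳ (sgn (d ∸ j)) ⟨
    sgn (d ∸ j) * + 0
      ≡⟨ cong (λ x → sgn (d ∸ j) * + x)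
              (k>n⇒nCk≡0 (∸-monoˡ-< (conj<beyond-durfee (≰⇒> d≰n)) j≤c)) ⟨
    sgn (d ∸ j) * + ((c ∸ j) C (d ∸ j))
      ≡⟨ closedForm-suc j j≤c (≮⇒≥ d≮j) ⟨
    closedForm j (suc c) d ∎
    where open ≡-Reasoning

  pathSum≡closedForm-next-column : ∀ {j} → 1 ≤ j → ∀ d →
    (∀ c → j ≤ c → c ≤ conj l d → pathSum l n j c d ≡ closedForm j c d) →
    ∀ r c → j ≤ c → c Nat.+ r ≡ conj l (suc d) → pathSum l n j c (suc d) ≡ closedForm j c (suc d)
  pathSum≡closedForm-next-column {j} 1≤j d column-d r c j≤c c+r≡λ′ = begin
    pathSum l n j c (suc d)
      ≡⟨ pathSum-last-step l n j {c} {suc d} cd ⟩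
    (emptyPathSum l n j c (suc d) + pathSum l n j (suc c) (suc d)) + pathSum l n j c d
      ≡⟨ cong₂ _+_ (below r c+r≡λ′) (column-d c j≤c (≤-trans c≤λ′ (conj-suc≤conj l d))) ⟩
    closedForm j (suc c) (suc d) + closedForm j c d
      ≡⟨ closedForm-pascal j j≤c ⟨
    closedForm j c (suc d) ∎
    where
    open ≡-Reasoning
    1≤c = ≤-trans 1≤j j≤c
    c≤λ′ : c ≤ conj l (suc d)
    c≤λ′ = subst (c ≤_) c+r≡λ′ (m≤m+n c r)
    cd : Box l c (suc d)
    cd = box 1≤c (s≤s z≤n) (≤-conj⇒≤-part l↓ 1≤c c≤λ′)
    below : ∀ r → c Nat.+ r ≡ conj l (suc d) →
      emptyPathSum l n j c (suc d) + pathSum l n j (suc c) (suc d)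
        ≡ closedForm j (suc c) (suc d)
    below zero c+0≡λ′ = trans
      (cong₂ _+_ (emptyPathSum-bottom j≤c c≡λ′ cd)
                 (pathSum-outside l n j {suc c} {suc d} ¬box))
      (ℤ.+-identityʳ _)
      where
      c≡λ′ = trans (sym (+-identityʳ c)) c+0≡λ′
      ¬box : ¬ Box l (suc c) (suc d)
      ¬box (box _ _ p) = <-irrefl c≡λ′ (≤-part⇒≤-conj l↓ (s≤s z≤n) (s≤s z≤n) p)
    below (suc r) c+r≡λ′ = trans
      (cong₂ _+_
        (emptyPathSum-off-bottom l n j {c} {suc d} λ c≡λ′ →
          m+1+n≢m c (trans c+r≡λ′ (sym c≡λ′)))
        (pathSum≡closedForm-next-column 1≤j d column-d r (suc c) (m≤n⇒m≤1+n j≤c)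
          (trans (sym (+-suc c r)) c+r≡λ′)))
      (ℤ.+-identityˡ _)

  pathSum≡closedForm : ∀ {j} → 1 ≤ j → ∀ d c → j ≤ c → c ≤ conj l d →
    pathSum l n j c d ≡ closedForm j c d
  pathSum≡closedForm {j} 1≤j zero c _ _ =
    trans (pathSum-outside l n j {c} {0} λ ()) (sym (closedForm-< j 1≤j))
  pathSum≡closedForm 1≤j (suc d) c j≤c c≤λ′ =
    pathSum≡closedForm-next-column 1≤j d (pathSum≡closedForm 1≤j d)
      (conj l (suc d) ∸ c) c j≤c (m+[n∸m]≡n c≤λ′)

mainTheorem3 : (l : List ℕ) → IsPartition l → (n : ℕ) → IsDurfee l n →
    ∀ i j → 1 ≤ j → j ≤ i → i ≤ n →
      sumFromTo j n (λ k → sgn (k ∸ j) * (+ Dpaths l i k * + ((conj l k ∸ j) C (k ∸ j))))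
        ≡ δ i j
mainTheorem3 l l↓ n durfee i j 1≤j j≤i i≤n = begin
  pathSum l n j i (part l i)             ≡⟨ pathSum≡closedForm l↓ durfee 1≤j (part l i) i j≤i i≤λ′λᵢ ⟩
  closedForm j i (part l i)              ≡⟨ closedForm-≥ j (≤-trans j≤i i≤λᵢ) ⟩
  signedBinomial (i ∸ j) (part l i ∸ j)  ≡⟨ signedBinomial-δ (∸-monoˡ-≤ j i≤λᵢ) ⟩
  δ (i ∸ j) 0                            ≡⟨ δ-∸ j≤i ⟩
  δ i j                                  ∎
  where
  open ≡-Reasoning
  1≤i = ≤-trans 1≤j j≤i
  i≤λᵢ = ≤-part-diagonal l↓ durfee 1≤i i≤n
  i≤λ′λᵢ = ≤-part⇒≤-conj l↓ 1≤i (≤-trans 1≤i i≤λᵢ) ≤-refl
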